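{- For every odd integer $d\ge 3$ the equation $a^2+b^2+c^2=3d^2$ has a non-trivial integer solution, i.e. there exist integers $a,b,c$ with $a^2+b^2+c^2=3d^2$ and $(|a|,|b|,|c|)\neq(d,d,d)$. -}

-- Let p be a prime factor of the odd number d; p is odd. Since −1 is a sum of two squares
-- modulo p (pigeonhole), Euler's descent with centred residues writes p = t² + x² + y² + z².
-- Conjugating e₁i + e₂j + e₃k by the quaternion q = t + xi + yj + zk multiplies squared lengths
-- by p², so e = (1,1,1), (1,1,−1), (1,−1,1) give three vectors of squared length 3p². If all
-- three were (±p, ±p, ±p), then t² + z² − x² − y² and t² + y² − x² − z², which are halves of
-- differences of their coordinates, would lie in {0, ±p}; being odd they are ±p, which forces
-- (x² + y²)(t² + z²) = 0 = (x² + z²)(t² + y²). Then three of t, x, y, z vanish and the prime p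
-- would be a square. Multiplying a non-trivial solution for p by d / p gives one for d.
module Submission where

open import Data.Empty using (⊥; ⊥-elim)
open import Data.Fin using (Fin; toℕ; fromℕ<; splitAt; join)
open import Data.Fin.Properties
  using (pigeonhole; fromℕ<-injective; toℕ-injective; toℕ<n; join-splitAt)
open import Data.Integer
open import Data.Integer.DivMod using (_/ℕ_; _%ℕ_; a≡a%ℕn+[a/ℕn]*n; n%ℕd<d)
open import Data.Integer.Divisibility.Signed
  using (_∣_; divides; quotient; ∣-refl; ∣m∣n⇒∣m+n; ∣m⇒∣m*n; ∣m⇒∣-m; ∣⇒∣ᵤ; ∣ᵤ⇒∣)
import Data.Integer.Properties as ℤ
open import Data.Integer.Solver using (module +-*-Solver)
open import Data.Integer.Tactic.RingSolver using (solve-∀)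
open import Data.List using (_∷_)
open import Data.List.Relation.Unary.All using (_∷_)
import Data.Nat as ℕ
import Data.Nat.Divisibility as ℕ
open import Data.Nat.Induction using (<-rec)
open import Data.Nat.ListAction using (product)
open import Data.Nat.Primality
  using (Prime; euclidsLemma; prime⇒irreducible; prime⇒nonTrivial; prime⇒nonZero)
open import Data.Nat.Primality.Factorisation using (factorise)
import Data.Nat.Properties as ℕ
import Data.Nat.Tactic.RingSolver as ℕ
open import Data.Product using (_×_; _,_; ∃-syntax; proj₁; proj₂)
open import Data.Sum using (_⊎_; inj₁; inj₂; [_,_]′)
open import Function using (_∘_)
open import Relation.Binary.Definitions using (tri<; tri≈; tri>)
open import Relation.Binary.PropositionalEquality
open import Relation.Nullary using (¬_; Dec; yes; no; contradiction)
open import Relation.Nullary.Decidable using (_×-dec_)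

open +-*-Solver using (Polynomial; _:+_; _:-_; _:*_; :-_; con; _:=_)

Odd : ℤ → Set
Odd n = ∃[ k ] n ≡ + 2 * k + + 1

norm₃ : ℤ × ℤ × ℤ → ℤ
norm₃ (a , b , c) = a * a + b * b + c * c

norm₄ : ℤ → ℤ → ℤ → ℤ → ℤ
norm₄ a b c d = a * a + b * b + c * c + d * d

SumOfFourSquares : ℤ → Set
SumOfFourSquares n = ∃[ a ] ∃[ b ] ∃[ c ] ∃[ d ] norm₄ a b c d ≡ n

IsTrivial : ℤ → ℤ × ℤ × ℤ → Set
IsTrivial d (a , b , c) = ∣ a ∣ ≡ ∣ d ∣ × ∣ b ∣ ≡ ∣ d ∣ × ∣ c ∣ ≡ ∣ d ∣

trivial? : ∀ d v → Dec (IsTrivial d v)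
trivial? d (a , b , c) = ∣ a ∣ ℕ.≟ ∣ d ∣ ×-dec ∣ b ∣ ℕ.≟ ∣ d ∣ ×-dec ∣ c ∣ ℕ.≟ ∣ d ∣

NontrivialSolution : ℤ → Set
NontrivialSolution d =
  ∃[ a ] ∃[ b ] ∃[ c ] (a * a + b * b + c * c ≡ + 3 * (d * d) × ¬ IsTrivial d (a , b , c))

2i≢2j+1 : ∀ i j → + 2 * i ≢ + 2 * j + + 1
2i≢2j+1 i j 2i≡2j+1 = ℕ.even≢odd ∣ i - j ∣ 0 (begin
  2 ℕ.* ∣ i - j ∣              ≡⟨ ℤ.abs-* (+ 2) (i - j) ⟨
  ∣ + 2 * (i - j) ∣            ≡⟨ cong ∣_∣ (distrib i j) ⟩
  ∣ + 2 * i - + 2 * j ∣        ≡⟨ cong (λ k → ∣ k - + 2 * j ∣) 2i≡2j+1 ⟩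
  ∣ + 2 * j + + 1 - + 2 * j ∣  ≡⟨ cong ∣_∣ (cancel (+ 2 * j)) ⟩
  1                            ∎)
  where
  open ≡-Reasoning
  distrib : ∀ i j → + 2 * (i - j) ≡ + 2 * i - + 2 * j
  distrib = solve-∀
  cancel : ∀ k → k + + 1 - k ≡ + 1
  cancel = solve-∀

even-or-odd : ∀ n → ∃[ h ] (n ≡ h ℕ.+ h ⊎ n ≡ ℕ.suc (h ℕ.+ h))
even-or-odd ℕ.zero    = 0 , inj₁ refl
even-or-odd (ℕ.suc n) with even-or-odd n
... | h , inj₁ n≡h+h   = h , inj₂ (cong ℕ.suc n≡h+h)
... | h , inj₂ n≡1+h+h = ℕ.suc h , inj₁ (cong ℕ.suc (trans n≡1+h+h (sym (ℕ.+-suc h h))))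

1+h+h-odd : ∀ h → Odd (+ ℕ.suc (h ℕ.+ h))
1+h+h-odd h = + h , (begin
  + ℕ.suc (h ℕ.+ h)  ≡⟨ ℤ.pos-+ 1 (h ℕ.+ h) ⟩
  + 1 + + (h ℕ.+ h)  ≡⟨ cong (λ k → + 1 + k) (ℤ.pos-+ h h) ⟩
  + 1 + (+ h + + h)  ≡⟨ rearrange (+ h) ⟩
  + 2 * + h + + 1    ∎)
  where
  open ≡-Reasoning
  rearrange : ∀ k → + 1 + (k + k) ≡ + 2 * k + + 1
  rearrange = solve-∀

∣odd⇒odd : ∀ {n p} → Odd (+ n) → p ℕ.∣ n → ∃[ h ] p ≡ ℕ.suc (h ℕ.+ h)
∣odd⇒odd {n} {p} (k , n≡2k+1) (ℕ.divides e n≡e*p) with even-or-odd p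
... | h , inj₂ p≡1+h+h = h , p≡1+h+h
... | h , inj₁ p≡h+h   = ⊥-elim (2i≢2j+1 (+ (e ℕ.* h)) k (trans (sym n≡2eh) n≡2k+1))
  where
  open ≡-Reasoning
  double : ∀ k → k + k ≡ + 2 * k
  double = solve-∀
  n≡2eh : + n ≡ + 2 * + (e ℕ.* h)
  n≡2eh = begin
    + n                        ≡⟨ cong +_ (trans n≡e*p (cong (e ℕ.*_) p≡h+h)) ⟩
    + (e ℕ.* (h ℕ.+ h))        ≡⟨ cong +_ (ℕ.*-distribˡ-+ e h h) ⟩
    + (e ℕ.* h ℕ.+ e ℕ.* h)    ≡⟨ ℤ.pos-+ (e ℕ.* h) (e ℕ.* h) ⟩
    + (e ℕ.* h) + + (e ℕ.* h)  ≡⟨ double (+ (e ℕ.* h)) ⟩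
    + 2 * + (e ℕ.* h)          ∎

i*i≡+∣i∣*∣i∣ : ∀ i → i * i ≡ + (∣ i ∣ ℕ.* ∣ i ∣)
i*i≡+∣i∣*∣i∣ (+ n)    = sym (ℤ.pos-* n n)
i*i≡+∣i∣*∣i∣ -[1+ n ] = refl

∣i∣≡∣j∣⇒i*i≡j*j : ∀ i j → ∣ i ∣ ≡ ∣ j ∣ → i * i ≡ j * j
∣i∣≡∣j∣⇒i*i≡j*j i j ∣i∣≡∣j∣ =
  trans (i*i≡+∣i∣*∣i∣ i) (trans (cong (λ n → + (n ℕ.* n)) ∣i∣≡∣j∣) (sym (i*i≡+∣i∣*∣i∣ j)))

i*i≡j*j⇒i≡j⊎i≡-j : ∀ i j → i * i ≡ j * j → i ≡ j ⊎ i ≡ - j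
i*i≡j*j⇒i≡j⊎i≡-j i j i²≡j² =
  [ inj₁ ∘ ℤ.i-j≡0⇒i≡j i j , inj₂ ∘ i+j≡0⇒i≡-j ]′
    (ℤ.i*j≡0⇒i≡0∨j≡0 (i - j) (trans (factor i j) (ℤ.i≡j⇒i-j≡0 i²≡j²)))
  where
  factor : ∀ i j → (i - j) * (i + j) ≡ i * i - j * j
  factor = solve-∀
  add-sub : ∀ i j → i ≡ i + j - j
  add-sub = solve-∀
  i+j≡0⇒i≡-j : i + j ≡ 0ℤ → i ≡ - j
  i+j≡0⇒i≡-j i+j≡0 = trans (add-sub i j) (trans (cong (_- j) i+j≡0) (ℤ.+-identityˡ (- j)))

n*n≡m*m⇒n≡m : ∀ {n m} → n ℕ.* n ≡ m ℕ.* m → n ≡ m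
n*n≡m*m⇒n≡m {n} {m} n²≡m² with ℕ.<-cmp n m
... | tri< n<m _ _ = contradiction n²≡m² (ℕ.<⇒≢ (ℕ.*-mono-< n<m n<m))
... | tri≈ _ n≡m _ = n≡m
... | tri> _ _ m<n = contradiction (sym n²≡m²) (ℕ.<⇒≢ (ℕ.*-mono-< m<n m<n))

i*i+j*j≡0⇒i≡0×j≡0 : ∀ i j → i * i + j * j ≡ 0ℤ → i ≡ 0ℤ × j ≡ 0ℤ
i*i+j*j≡0⇒i≡0×j≡0 i j i²+j²≡0 =
  square≡0 i (ℕ.m+n≡0⇒m≡0 _ sum≡0) , square≡0 j (ℕ.m+n≡0⇒n≡0 _ sum≡0)
  where
  open ≡-Reasoning
  sum≡0 : ∣ i ∣ ℕ.* ∣ i ∣ ℕ.+ ∣ j ∣ ℕ.* ∣ j ∣ ≡ 0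
  sum≡0 = ℤ.+-injective (begin
    + (∣ i ∣ ℕ.* ∣ i ∣ ℕ.+ ∣ j ∣ ℕ.* ∣ j ∣)     ≡⟨ ℤ.pos-+ (∣ i ∣ ℕ.* ∣ i ∣) (∣ j ∣ ℕ.* ∣ j ∣) ⟩
    + (∣ i ∣ ℕ.* ∣ i ∣) + + (∣ j ∣ ℕ.* ∣ j ∣)  ≡⟨ cong₂ _+_ (i*i≡+∣i∣*∣i∣ i) (i*i≡+∣i∣*∣i∣ j) ⟨
    i * i + j * j                              ≡⟨ i²+j²≡0 ⟩
    0ℤ                                         ∎)
  square≡0 : ∀ k → ∣ k ∣ ℕ.* ∣ k ∣ ≡ 0 → k ≡ 0ℤ
  square≡0 k k²≡0 = ℤ.∣i∣≡0⇒i≡0 (n*n≡m*m⇒n≡m {m = 0} k²≡0)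

norm₄≡+∣∣² : ∀ a b c d →
  norm₄ a b c d ≡ + (∣ a ∣ ℕ.* ∣ a ∣ ℕ.+ ∣ b ∣ ℕ.* ∣ b ∣ ℕ.+ ∣ c ∣ ℕ.* ∣ c ∣ ℕ.+ ∣ d ∣ ℕ.* ∣ d ∣)
norm₄≡+∣∣² a b c d = begin
  a * a + b * b + c * c + d * d
    ≡⟨ cong₂ _+_ (cong₂ _+_ (cong₂ _+_ (i*i≡+∣i∣*∣i∣ a) (i*i≡+∣i∣*∣i∣ b)) (i*i≡+∣i∣*∣i∣ c)) (i*i≡+∣i∣*∣i∣ d) ⟩
  + A + + B + + C + + D      ≡⟨ cong (λ k → k + + C + + D) (ℤ.pos-+ A B) ⟨
  + (A ℕ.+ B) + + C + + D    ≡⟨ cong (_+ + D) (ℤ.pos-+ (A ℕ.+ B) C) ⟨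
  + (A ℕ.+ B ℕ.+ C) + + D    ≡⟨ ℤ.pos-+ (A ℕ.+ B ℕ.+ C) D ⟨
  + (A ℕ.+ B ℕ.+ C ℕ.+ D)    ∎
  where
  open ≡-Reasoning
  A = ∣ a ∣ ℕ.* ∣ a ∣
  B = ∣ b ∣ ℕ.* ∣ b ∣
  C = ∣ c ∣ ℕ.* ∣ c ∣
  D = ∣ d ∣ ℕ.* ∣ d ∣

+u≡q*n⇒u≡∣q∣*n : ∀ {u} q n → + u ≡ q * + n → u ≡ ∣ q ∣ ℕ.* n
+u≡q*n⇒u≡∣q∣*n q n +u≡q*n = trans (cong ∣_∣ +u≡q*n) (ℤ.abs-* q (+ n))

m∣n∧n<m⇒n≡0 : ∀ {m n} → m ℕ.∣ n → n ℕ.< m → n ≡ 0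
m∣n∧n<m⇒n≡0 {n = ℕ.zero}  _   _   = refl
m∣n∧n<m⇒n≡0 {n = ℕ.suc _} m∣n n<m = contradiction m∣n (ℕ.>⇒∤ n<m)

%ℕ-≡⇒∣ : ∀ {a b} n .{{_ : ℕ.NonZero n}} → a %ℕ n ≡ b %ℕ n → + n ∣ a - b
%ℕ-≡⇒∣ {a} {b} n a%n≡b%n = divides (a /ℕ n - b /ℕ n) (begin
  a - b                          ≡⟨ cong₂ _-_ (a≡a%ℕn+[a/ℕn]*n a n) (a≡a%ℕn+[a/ℕn]*n b n) ⟩
  (+ (a %ℕ n) + qa * + n) - (+ (b %ℕ n) + qb * + n)
                                 ≡⟨ cong (λ r → (+ r + qa * + n) - (+ (b %ℕ n) + qb * + n)) a%n≡b%n ⟩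
  (+ (b %ℕ n) + qa * + n) - (+ (b %ℕ n) + qb * + n)
                                 ≡⟨ cancel (+ (b %ℕ n)) qa qb (+ n) ⟩
  (qa - qb) * + n                ∎)
  where
  open ≡-Reasoning
  qa = a /ℕ n
  qb = b /ℕ n
  cancel : ∀ r q q′ n → (r + q * n) - (r + q′ * n) ≡ (q - q′) * n
  cancel = solve-∀

+-≤-≡⇒≡ : ∀ {a b A B} → a ℕ.≤ A → b ℕ.≤ B → a ℕ.+ b ≡ A ℕ.+ B → a ≡ A × b ≡ B
+-≤-≡⇒≡ a≤A b≤B a+b≡A+B with ℕ.m≤n⇒m<n∨m≡n a≤A | ℕ.m≤n⇒m<n∨m≡n b≤B
... | inj₁ a<A | _        = contradiction a+b≡A+B (ℕ.<⇒≢ (ℕ.+-mono-<-≤ a<A b≤B))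
... | inj₂ _   | inj₁ b<B = contradiction a+b≡A+B (ℕ.<⇒≢ (ℕ.+-mono-≤-< a≤A b<B))
... | inj₂ a≡A | inj₂ b≡B = a≡A , b≡B

+₄-≤-≡⇒≡ : ∀ {a₁ a₂ a₃ a₄ A₁ A₂ A₃ A₄} →
  a₁ ℕ.≤ A₁ → a₂ ℕ.≤ A₂ → a₃ ℕ.≤ A₃ → a₄ ℕ.≤ A₄ →
  a₁ ℕ.+ a₂ ℕ.+ a₃ ℕ.+ a₄ ≡ A₁ ℕ.+ A₂ ℕ.+ A₃ ℕ.+ A₄ →
  a₁ ≡ A₁ × a₂ ≡ A₂ × a₃ ≡ A₃ × a₄ ≡ A₄
+₄-≤-≡⇒≡ a₁≤ a₂≤ a₃≤ a₄≤ sum≡ =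
  let a₁₂₃≡ , a₄≡ = +-≤-≡⇒≡ (ℕ.+-mono-≤ (ℕ.+-mono-≤ a₁≤ a₂≤) a₃≤) a₄≤ sum≡
      a₁₂≡ , a₃≡  = +-≤-≡⇒≡ (ℕ.+-mono-≤ a₁≤ a₂≤) a₃≤ a₁₂₃≡
      a₁≡ , a₂≡   = +-≤-≡⇒≡ a₁≤ a₂≤ a₁₂≡
  in  a₁≡ , a₂≡ , a₃≡ , a₄≡

centred-divMod : ∀ m .{{_ : ℕ.NonZero m}} a → ∃[ y ] ∃[ k ] a ≡ y + + m * k × 2 ℕ.* ∣ y ∣ ℕ.≤ m
centred-divMod m a = centre (2 ℕ.* r ℕ.≤? m)
  where
  r = a %ℕ m
  q = a /ℕ m
  r≤m : r ℕ.≤ m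
  r≤m = ℕ.<⇒≤ (n%ℕd<d a m)
  a≡r+mq : a ≡ + r + + m * q
  a≡r+mq = trans (a≡a%ℕn+[a/ℕn]*n a m) (cong (λ k → + r + k) (ℤ.*-comm q (+ m)))
  shift : ∀ r m q → r + m * q ≡ (r - m) + m * (q + 1ℤ)
  shift = solve-∀
  centre : Dec (2 ℕ.* r ℕ.≤ m) → ∃[ y ] ∃[ k ] a ≡ y + + m * k × 2 ℕ.* ∣ y ∣ ℕ.≤ m
  centre (yes 2r≤m) = + r , q , a≡r+mq , 2r≤m
  centre (no 2r≰m)  = + r - + m , q + 1ℤ , trans a≡r+mq (shift (+ r) (+ m) q) , 2∣r-m∣≤m
    where
    open ℕ.≤-Reasoning
    m∸r≤r : m ℕ.∸ r ℕ.≤ r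
    m∸r≤r = ℕ.m≤n+o⇒m∸n≤o m r
      (ℕ.≤-trans (ℕ.<⇒≤ (ℕ.≰⇒> 2r≰m)) (ℕ.≤-reflexive (cong (r ℕ.+_) (ℕ.+-identityʳ r))))
    2∣r-m∣≤m : 2 ℕ.* ∣ + r - + m ∣ ℕ.≤ m
    2∣r-m∣≤m = begin
      2 ℕ.* ∣ + r - + m ∣      ≡⟨ cong (λ k → 2 ℕ.* ∣ k ∣) (ℤ.m-n≡m⊖n r m) ⟩
      2 ℕ.* ∣ r ⊖ m ∣          ≡⟨ cong (2 ℕ.*_) (ℤ.∣⊖∣-≤ r≤m) ⟩
      2 ℕ.* (m ℕ.∸ r)          ≡⟨ cong ((m ℕ.∸ r) ℕ.+_) (ℕ.+-identityʳ (m ℕ.∸ r)) ⟩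
      (m ℕ.∸ r) ℕ.+ (m ℕ.∸ r)  ≤⟨ ℕ.+-monoʳ-≤ (m ℕ.∸ r) m∸r≤r ⟩
      (m ℕ.∸ r) ℕ.+ r          ≡⟨ ℕ.m∸n+n≡m r≤m ⟩
      m                        ∎

-- norm₄ (and conjugate below) as ring-solver syntax: the reflective solver treats defined
-- functions as opaque constants, so identities involving them go through +-*-Solver.
norm₄ᴾ : ∀ {n} → Polynomial n → Polynomial n → Polynomial n → Polynomial n → Polynomial n
norm₄ᴾ a b c d = a :* a :+ b :* b :+ c :* c :+ d :* d

norm₄-scale : ∀ m a b c d → norm₄ (m * a) (m * b) (m * c) (m * d) ≡ m * (m * norm₄ a b c d)
norm₄-scale = +-*-Solver.solve 5 (λ m a b c d →
  norm₄ᴾ (m :* a) (m :* b) (m :* c) (m :* d) := m :* (m :* norm₄ᴾ a b c d)) refl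

norm₄-shift : ∀ y₁ y₂ y₃ y₄ k₁ k₂ k₃ k₄ m →
  norm₄ (y₁ + m * k₁) (y₂ + m * k₂) (y₃ + m * k₃) (y₄ + m * k₄) ≡
  norm₄ y₁ y₂ y₃ y₄ +
    m * (+ 2 * y₁ * k₁ + + 2 * y₂ * k₂ + + 2 * y₃ * k₃ + + 2 * y₄ * k₄ + m * norm₄ k₁ k₂ k₃ k₄)
norm₄-shift = +-*-Solver.solve 9 (λ y₁ y₂ y₃ y₄ k₁ k₂ k₃ k₄ m →
  norm₄ᴾ (y₁ :+ m :* k₁) (y₂ :+ m :* k₂) (y₃ :+ m :* k₃) (y₄ :+ m :* k₄) :=
  norm₄ᴾ y₁ y₂ y₃ y₄ :+
    m :* (con (+ 2) :* y₁ :* k₁ :+ con (+ 2) :* y₂ :* k₂ :+ con (+ 2) :* y₃ :* k₃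
          :+ con (+ 2) :* y₄ :* k₄ :+ m :* norm₄ᴾ k₁ k₂ k₃ k₄)) refl

euler-shift : ∀ y₁ y₂ y₃ y₄ k₁ k₂ k₃ k₄ m →
  norm₄ y₁ y₂ y₃ y₄ * norm₄ (y₁ + m * k₁) (y₂ + m * k₂) (y₃ + m * k₃) (y₄ + m * k₄) ≡
  norm₄ (norm₄ y₁ y₂ y₃ y₄ + m * (k₁ * y₁ + k₂ * y₂ + k₃ * y₃ + k₄ * y₄))
        (m * (k₁ * y₂ - k₂ * y₁ + k₃ * y₄ - k₄ * y₃))
        (m * (k₁ * y₃ - k₃ * y₁ + k₄ * y₂ - k₂ * y₄))
        (m * (k₁ * y₄ - k₄ * y₁ + k₂ * y₃ - k₃ * y₂))
euler-shift = +-*-Solver.solve 9 (λ y₁ y₂ y₃ y₄ k₁ k₂ k₃ k₄ m →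
  norm₄ᴾ y₁ y₂ y₃ y₄ :* norm₄ᴾ (y₁ :+ m :* k₁) (y₂ :+ m :* k₂) (y₃ :+ m :* k₃) (y₄ :+ m :* k₄) :=
  norm₄ᴾ (norm₄ᴾ y₁ y₂ y₃ y₄ :+ m :* (k₁ :* y₁ :+ k₂ :* y₂ :+ k₃ :* y₃ :+ k₄ :* y₄))
         (m :* (k₁ :* y₂ :- k₂ :* y₁ :+ k₃ :* y₄ :- k₄ :* y₃))
         (m :* (k₁ :* y₃ :- k₃ :* y₁ :+ k₄ :* y₂ :- k₂ :* y₄))
         (m :* (k₁ :* y₄ :- k₄ :* y₁ :+ k₂ :* y₃ :- k₃ :* y₂))) refl

module ShiftedQuadruple {m P : ℤ} .{{_ : NonZero m}} (y₁ y₂ y₃ y₄ k₁ k₂ k₃ k₄ : ℤ)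
  (N[y+mk]≡mP : norm₄ (y₁ + m * k₁) (y₂ + m * k₂) (y₃ + m * k₃) (y₄ + m * k₄) ≡ m * P) where

  private
    T : ℤ
    T = + 2 * y₁ * k₁ + + 2 * y₂ * k₂ + + 2 * y₃ * k₃ + + 2 * y₄ * k₄ + m * norm₄ k₁ k₂ k₃ k₄

    N[y]+mT≡mP : norm₄ y₁ y₂ y₃ y₄ + m * T ≡ m * P
    N[y]+mT≡mP = trans (sym (norm₄-shift y₁ y₂ y₃ y₄ k₁ k₂ k₃ k₄ m)) N[y+mk]≡mP

  m∣norm₄[y] : m ∣ norm₄ y₁ y₂ y₃ y₄
  m∣norm₄[y] = divides (P - T) (begin
    norm₄ y₁ y₂ y₃ y₄                  ≡⟨ add-sub (norm₄ y₁ y₂ y₃ y₄) (m * T) ⟩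
    norm₄ y₁ y₂ y₃ y₄ + m * T - m * T  ≡⟨ cong (_- m * T) N[y]+mT≡mP ⟩
    m * P - m * T                      ≡⟨ factor m P T ⟩
    (P - T) * m                        ∎)
    where
    open ≡-Reasoning
    add-sub : ∀ a b → a ≡ a + b - b
    add-sub = solve-∀
    factor : ∀ m P T → m * P - m * T ≡ (P - T) * m
    factor = solve-∀

  m∣quotient : ∀ {R} → norm₄ y₁ y₂ y₃ y₄ ≡ m * R → m ∣ R →
    m ∣ + 2 * y₁ → m ∣ + 2 * y₂ → m ∣ + 2 * y₃ → m ∣ + 2 * y₄ → m ∣ P
  m∣quotient {R} N[y]≡mR m∣R m∣2y₁ m∣2y₂ m∣2y₃ m∣2y₄ = subst (m ∣_) (sym P≡R+T) m∣R+T
    where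
    open ≡-Reasoning
    P≡R+T : P ≡ R + T
    P≡R+T = ℤ.*-cancelˡ-≡ m P (R + T) (begin
      m * P                      ≡⟨ N[y]+mT≡mP ⟨
      norm₄ y₁ y₂ y₃ y₄ + m * T  ≡⟨ cong (_+ m * T) N[y]≡mR ⟩
      m * R + m * T              ≡⟨ ℤ.*-distribˡ-+ m R T ⟨
      m * (R + T)                ∎)
    m∣R+T : m ∣ R + T
    m∣R+T = ∣m∣n⇒∣m+n m∣R
      (∣m∣n⇒∣m+n (∣m∣n⇒∣m+n (∣m∣n⇒∣m+n (∣m∣n⇒∣m+n (∣m⇒∣m*n k₁ m∣2y₁) (∣m⇒∣m*n k₂ m∣2y₂))
        (∣m⇒∣m*n k₃ m∣2y₃)) (∣m⇒∣m*n k₄ m∣2y₄)) (∣m⇒∣m*n (norm₄ k₁ k₂ k₃ k₄) ∣-refl))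

  euler-descent : ∀ {R} → norm₄ y₁ y₂ y₃ y₄ ≡ m * R → SumOfFourSquares (R * P)
  euler-descent {R} N[y]≡mR = w₁ , w₂ , w₃ , w₄ ,
    ℤ.*-cancelˡ-≡ m _ _ (ℤ.*-cancelˡ-≡ m _ _ (begin
      m * (m * norm₄ w₁ w₂ w₃ w₄)                ≡⟨ norm₄-scale m w₁ w₂ w₃ w₄ ⟨
      norm₄ (m * w₁) (m * w₂) (m * w₃) (m * w₄)  ≡⟨ cong (λ v → norm₄ v (m * w₂) (m * w₃) (m * w₄)) m*w₁≡ ⟩
      norm₄ (norm₄ y₁ y₂ y₃ y₄ + m * s) (m * w₂) (m * w₃) (m * w₄)
                                                 ≡⟨ euler-shift y₁ y₂ y₃ y₄ k₁ k₂ k₃ k₄ m ⟨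
      norm₄ y₁ y₂ y₃ y₄ * norm₄ (y₁ + m * k₁) (y₂ + m * k₂) (y₃ + m * k₃) (y₄ + m * k₄)
                                                 ≡⟨ cong₂ _*_ N[y]≡mR N[y+mk]≡mP ⟩
      (m * R) * (m * P)                          ≡⟨ regroup m R P ⟩
      m * (m * (R * P))                          ∎))
    where
    open ≡-Reasoning
    s  = k₁ * y₁ + k₂ * y₂ + k₃ * y₃ + k₄ * y₄
    w₁ = R + s
    w₂ = k₁ * y₂ - k₂ * y₁ + k₃ * y₄ - k₄ * y₃
    w₃ = k₁ * y₃ - k₃ * y₁ + k₄ * y₂ - k₂ * y₄
    w₄ = k₁ * y₄ - k₄ * y₁ + k₂ * y₃ - k₃ * y₂
    m*w₁≡ : m * w₁ ≡ norm₄ y₁ y₂ y₃ y₄ + m * s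
    m*w₁≡ = trans (ℤ.*-distribˡ-+ m R s) (cong (_+ m * s) (sym N[y]≡mR))
    regroup : ∀ m R P → (m * R) * (m * P) ≡ m * (m * (R * P))
    regroup = solve-∀

module CentredResidues {m : ℕ.ℕ} (a₁ a₂ a₃ a₄ : ℕ.ℕ)
  (2a₁≤m : 2 ℕ.* a₁ ℕ.≤ m) (2a₂≤m : 2 ℕ.* a₂ ℕ.≤ m) (2a₃≤m : 2 ℕ.* a₃ ℕ.≤ m) (2a₄≤m : 2 ℕ.* a₄ ℕ.≤ m)
  where

  private
    b₁ = 2 ℕ.* a₁
    b₂ = 2 ℕ.* a₂
    b₃ = 2 ℕ.* a₃
    b₄ = 2 ℕ.* a₄

    square-≤ : ∀ {b} → b ℕ.≤ m → b ℕ.* b ℕ.≤ m ℕ.* m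
    square-≤ b≤m = ℕ.*-mono-≤ b≤m b≤m

    doubled : ∀ a₁ a₂ a₃ a₄ →
      (2 ℕ.* a₁) ℕ.* (2 ℕ.* a₁) ℕ.+ (2 ℕ.* a₂) ℕ.* (2 ℕ.* a₂) ℕ.+
      (2 ℕ.* a₃) ℕ.* (2 ℕ.* a₃) ℕ.+ (2 ℕ.* a₄) ℕ.* (2 ℕ.* a₄)
      ≡ 4 ℕ.* (a₁ ℕ.* a₁ ℕ.+ a₂ ℕ.* a₂ ℕ.+ a₃ ℕ.* a₃ ℕ.+ a₄ ℕ.* a₄)
    doubled = ℕ.solve-∀

    quadrupled : ∀ m → m ℕ.* m ℕ.+ m ℕ.* m ℕ.+ m ℕ.* m ℕ.+ m ℕ.* m ≡ 4 ℕ.* (m ℕ.* m)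
    quadrupled = ℕ.solve-∀

    Σb²≡4rm : ∀ {r} → a₁ ℕ.* a₁ ℕ.+ a₂ ℕ.* a₂ ℕ.+ a₃ ℕ.* a₃ ℕ.+ a₄ ℕ.* a₄ ≡ r ℕ.* m →
      b₁ ℕ.* b₁ ℕ.+ b₂ ℕ.* b₂ ℕ.+ b₃ ℕ.* b₃ ℕ.+ b₄ ℕ.* b₄ ≡ 4 ℕ.* (r ℕ.* m)
    Σb²≡4rm Σa²≡rm = trans (doubled a₁ a₂ a₃ a₄) (cong (4 ℕ.*_) Σa²≡rm)

    Σb²≤Σm² : b₁ ℕ.* b₁ ℕ.+ b₂ ℕ.* b₂ ℕ.+ b₃ ℕ.* b₃ ℕ.+ b₄ ℕ.* b₄ ℕ.≤ m ℕ.* m ℕ.+ m ℕ.* m ℕ.+ m ℕ.* m ℕ.+ m ℕ.* m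
    Σb²≤Σm² = ℕ.+-mono-≤ (ℕ.+-mono-≤ (ℕ.+-mono-≤ (square-≤ 2a₁≤m) (square-≤ 2a₂≤m)) (square-≤ 2a₃≤m))
      (square-≤ 2a₄≤m)

  residues-quotient-≤ : ∀ {r} .{{_ : ℕ.NonZero m}} →
    a₁ ℕ.* a₁ ℕ.+ a₂ ℕ.* a₂ ℕ.+ a₃ ℕ.* a₃ ℕ.+ a₄ ℕ.* a₄ ≡ r ℕ.* m → r ℕ.≤ m
  residues-quotient-≤ {r} Σa²≡rm = ℕ.*-cancelʳ-≤ r m m (ℕ.*-cancelˡ-≤ 4 (begin
    4 ℕ.* (r ℕ.* m)                                      ≡⟨ Σb²≡4rm {r} Σa²≡rm ⟨
    b₁ ℕ.* b₁ ℕ.+ b₂ ℕ.* b₂ ℕ.+ b₃ ℕ.* b₃ ℕ.+ b₄ ℕ.* b₄  ≤⟨ Σb²≤Σm² ⟩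
    m ℕ.* m ℕ.+ m ℕ.* m ℕ.+ m ℕ.* m ℕ.+ m ℕ.* m         ≡⟨ quadrupled m ⟩
    4 ℕ.* (m ℕ.* m)                                      ∎))
    where open ℕ.≤-Reasoning

  residues-extremal : ∀ {r} → a₁ ℕ.* a₁ ℕ.+ a₂ ℕ.* a₂ ℕ.+ a₃ ℕ.* a₃ ℕ.+ a₄ ℕ.* a₄ ≡ r ℕ.* m →
    r ≡ 0 ⊎ r ≡ m → m ℕ.∣ b₁ × m ℕ.∣ b₂ × m ℕ.∣ b₃ × m ℕ.∣ b₄
  residues-extremal Σa²≡0 (inj₁ refl) =
    let 0≡a₁² , 0≡a₂² , 0≡a₃² , 0≡a₄² = +₄-≤-≡⇒≡ ℕ.z≤n ℕ.z≤n ℕ.z≤n ℕ.z≤n (sym Σa²≡0)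
    in  m∣2a a₁ 0≡a₁² , m∣2a a₂ 0≡a₂² , m∣2a a₃ 0≡a₃² , m∣2a a₄ 0≡a₄²
    where
    m∣2a : ∀ a → 0 ≡ a ℕ.* a → m ℕ.∣ 2 ℕ.* a
    m∣2a a 0≡a² with n*n≡m*m⇒n≡m {a} {0} (sym 0≡a²)
    ... | refl = m ℕ.∣0
  residues-extremal Σa²≡mm (inj₂ refl) =
    let b₁²≡m² , b₂²≡m² , b₃²≡m² , b₄²≡m² =
          +₄-≤-≡⇒≡ (square-≤ 2a₁≤m) (square-≤ 2a₂≤m) (square-≤ 2a₃≤m) (square-≤ 2a₄≤m)
            (trans (Σb²≡4rm {m} Σa²≡mm) (sym (quadrupled m)))
    in  m∣b b₁²≡m² , m∣b b₂²≡m² , m∣b b₃²≡m² , m∣b b₄²≡m²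
    where
    m∣b : ∀ {b} → b ℕ.* b ≡ m ℕ.* m → m ℕ.∣ b
    m∣b b²≡m² = ℕ.∣-reflexive (sym (n*n≡m*m⇒n≡m b²≡m²))

module _ {p : ℕ.ℕ} (prime : Prime p) where

  proper-divisor⇒⊥ : ∀ {m} → 1 ℕ.< m → m ℕ.< p → ¬ m ℕ.∣ p
  proper-divisor⇒⊥ 1<m m<p m∣p with prime⇒irreducible prime m∣p
  ... | inj₁ refl = ℕ.<-irrefl refl 1<m
  ... | inj₂ refl = ℕ.<-irrefl refl m<p

  descent-step : ∀ {m} → 1 ℕ.< m → m ℕ.< p → SumOfFourSquares (+ m * + p) →
    ∃[ r ] 0 ℕ.< r × r ℕ.< m × SumOfFourSquares (+ r * + p)
  descent-step {m} 1<m@(ℕ.s≤s (ℕ.s≤s _)) m<p (a₁ , a₂ , a₃ , a₄ , N[a]≡mp)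
    with centred-divMod m a₁ | centred-divMod m a₂ | centred-divMod m a₃ | centred-divMod m a₄
  ... | y₁ , k₁ , refl , 2y₁≤m | y₂ , k₂ , refl , 2y₂≤m | y₃ , k₃ , refl , 2y₃≤m | y₄ , k₄ , refl , 2y₄≤m
    = descend (ℕ.m≤n⇒m<n∨m≡n (residues-quotient-≤ Σ∣y∣²≡rm))
    where
    open ShiftedQuadruple {+ m} {+ p} y₁ y₂ y₃ y₄ k₁ k₂ k₃ k₄ N[a]≡mp
    open CentredResidues (∣ y₁ ∣) (∣ y₂ ∣) (∣ y₃ ∣) (∣ y₄ ∣) 2y₁≤m 2y₂≤m 2y₃≤m 2y₄≤m

    r : ℕ.ℕ
    r = ∣ quotient m∣norm₄[y] ∣

    Σ∣y∣²≡rm : ∣ y₁ ∣ ℕ.* ∣ y₁ ∣ ℕ.+ ∣ y₂ ∣ ℕ.* ∣ y₂ ∣ ℕ.+ ∣ y₃ ∣ ℕ.* ∣ y₃ ∣ ℕ.+ ∣ y₄ ∣ ℕ.* ∣ y₄ ∣ ≡ r ℕ.* m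
    Σ∣y∣²≡rm = +u≡q*n⇒u≡∣q∣*n (quotient m∣norm₄[y]) m
      (trans (sym (norm₄≡+∣∣² y₁ y₂ y₃ y₄)) (_∣_.equality m∣norm₄[y]))

    N[y]≡mr : norm₄ y₁ y₂ y₃ y₄ ≡ + m * + r
    N[y]≡mr = trans (norm₄≡+∣∣² y₁ y₂ y₃ y₄) (trans (cong +_ (trans Σ∣y∣²≡rm (ℕ.*-comm r m))) (ℤ.pos-* m r))

    extremal⇒⊥ : ¬ (r ≡ 0 ⊎ r ≡ m)
    extremal⇒⊥ r≡0∨m =
      let m∣2y₁ , m∣2y₂ , m∣2y₃ , m∣2y₄ = residues-extremal Σ∣y∣²≡rm r≡0∨m
      in  proper-divisor⇒⊥ 1<m m<p (∣⇒∣ᵤ (m∣quotient {+ r} N[y]≡mr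
            (∣ᵤ⇒∣ (m∣r r≡0∨m)) (m∣2y m∣2y₁) (m∣2y m∣2y₂) (m∣2y m∣2y₃) (m∣2y m∣2y₄)))
      where
      m∣r : r ≡ 0 ⊎ r ≡ m → m ℕ.∣ r
      m∣r (inj₁ r≡0) = subst (m ℕ.∣_) (sym r≡0) (m ℕ.∣0)
      m∣r (inj₂ r≡m) = ℕ.∣-reflexive (sym r≡m)
      m∣2y : ∀ {y} → m ℕ.∣ 2 ℕ.* ∣ y ∣ → + m ∣ + 2 * y
      m∣2y {y} = ∣ᵤ⇒∣ ∘ subst (m ℕ.∣_) (sym (ℤ.abs-* (+ 2) y))

    descend : r ℕ.< m ⊎ r ≡ m → ∃[ r ] 0 ℕ.< r × r ℕ.< m × SumOfFourSquares (+ r * + p)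
    descend (inj₂ r≡m) = ⊥-elim (extremal⇒⊥ (inj₂ r≡m))
    descend (inj₁ r<m) = r , ℕ.n≢0⇒n>0 (extremal⇒⊥ ∘ inj₁) , r<m , euler-descent {+ r} N[y]≡mr

  descent : ∀ m → 0 ℕ.< m → m ℕ.< p → SumOfFourSquares (+ m * + p) → SumOfFourSquares (+ p)
  descent = <-rec _ λ where
    ℕ.zero            _   ()  _   _
    (ℕ.suc ℕ.zero)    _   _   _   s → subst SumOfFourSquares (ℤ.*-identityˡ (+ p)) s
    (ℕ.suc (ℕ.suc _)) rec _   m<p s →
      let r , 0<r , r<m , s′ = descent-step (ℕ.s≤s (ℕ.s≤s ℕ.z≤n)) m<p s
      in  rec r<m 0<r (ℕ.<-trans r<m m<p) s′

module _ {h : ℕ.ℕ} (prime : Prime (ℕ.suc (h ℕ.+ h))) where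

  private
    p : ℕ.ℕ
    p = ℕ.suc (h ℕ.+ h)

  x+y<p : ∀ {x y} → x ℕ.≤ h → y ℕ.≤ h → x ℕ.+ y ℕ.< p
  x+y<p x≤h y≤h = ℕ.s≤s (ℕ.+-mono-≤ x≤h y≤h)

  squares-≡-mod-p⇒≡ : ∀ {x y} → x ℕ.≤ h → y ℕ.≤ h → + p ∣ + x * + x - + y * + y → x ≡ y
  squares-≡-mod-p⇒≡ {x} {y} x≤h y≤h p∣x²-y² =
    [ from-difference , from-sum ]′ (euclidsLemma ∣ + x - + y ∣ (x ℕ.+ y) prime p∣∣x-y∣[x+y])
    where
    factor : ∀ x y → x * x - y * y ≡ (x - y) * (x + y)
    factor = solve-∀
    p∣∣x-y∣[x+y] : p ℕ.∣ ∣ + x - + y ∣ ℕ.* (x ℕ.+ y)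
    p∣∣x-y∣[x+y] = subst (p ℕ.∣_)
      (trans (cong ∣_∣ (factor (+ x) (+ y)))
        (trans (ℤ.abs-* (+ x - + y) (+ x + + y)) (cong (λ k → ∣ + x - + y ∣ ℕ.* ∣ k ∣) (sym (ℤ.pos-+ x y)))))
      (∣⇒∣ᵤ p∣x²-y²)
    from-difference : p ℕ.∣ ∣ + x - + y ∣ → x ≡ y
    from-difference p∣∣x-y∣ = ℤ.+-injective (ℤ.i-j≡0⇒i≡j (+ x) (+ y) (ℤ.∣i∣≡0⇒i≡0
      (m∣n∧n<m⇒n≡0 p∣∣x-y∣ (ℕ.≤-<-trans (ℤ.∣i-j∣≤∣i∣+∣j∣ (+ x) (+ y)) (x+y<p x≤h y≤h)))))
    from-sum : p ℕ.∣ x ℕ.+ y → x ≡ y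
    from-sum p∣x+y = trans (ℕ.m+n≡0⇒m≡0 x x+y≡0) (sym (ℕ.m+n≡0⇒n≡0 x x+y≡0))
      where x+y≡0 = m∣n∧n<m⇒n≡0 p∣x+y (x+y<p x≤h y≤h)

  private
    -- The h + 1 squares x² and the h + 1 numbers −1 − y² (x, y ≤ h) are p + 1 integers,
    -- so two of them agree mod p; two of the same kind cannot.
    candidate : Fin (ℕ.suc h) ⊎ Fin (ℕ.suc h) → ℤ
    candidate (inj₁ x) = + toℕ x * + toℕ x
    candidate (inj₂ y) = - (+ 1 + + toℕ y * + toℕ y)

    ≤h : (x : Fin (ℕ.suc h)) → toℕ x ℕ.≤ h
    ≤h x = ℕ.s≤s⁻¹ (toℕ<n x)

    collision : ∀ u v → u ≢ v → + p ∣ candidate u - candidate v →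
      ∃[ x ] ∃[ y ] x ℕ.≤ h × y ℕ.≤ h × + p ∣ + 1 + + x * + x + + y * + y
    collision (inj₁ x) (inj₁ x′) x≢x′ p∣ =
      ⊥-elim (x≢x′ (cong inj₁ (toℕ-injective (squares-≡-mod-p⇒≡ (≤h x) (≤h x′) p∣))))
    collision (inj₂ y) (inj₂ y′) y≢y′ p∣ = ⊥-elim (y≢y′ (cong inj₂ (toℕ-injective (sym
      (squares-≡-mod-p⇒≡ (≤h y′) (≤h y) (subst (+ p ∣_) (swap (+ toℕ y) (+ toℕ y′)) p∣))))))
      where
      swap : ∀ a b → - (+ 1 + a * a) - - (+ 1 + b * b) ≡ b * b - a * a
      swap = solve-∀
    collision (inj₁ x) (inj₂ y) _ p∣ =
      toℕ x , toℕ y , ≤h x , ≤h y , subst (+ p ∣_) (rearrange (+ toℕ x) (+ toℕ y)) p∣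
      where
      rearrange : ∀ a b → a * a - - (+ 1 + b * b) ≡ + 1 + a * a + b * b
      rearrange = solve-∀
    collision (inj₂ y) (inj₁ x) _ p∣ =
      toℕ x , toℕ y , ≤h x , ≤h y , subst (+ p ∣_) (rearrange (+ toℕ x) (+ toℕ y)) (∣m⇒∣-m p∣)
      where
      rearrange : ∀ a b → - (- (+ 1 + b * b) - a * a) ≡ + 1 + a * a + b * b
      rearrange = solve-∀

    residue : ℤ → Fin p
    residue a = fromℕ< (n%ℕd<d a p)

    p<2[h+1] : p ℕ.< ℕ.suc h ℕ.+ ℕ.suc h
    p<2[h+1] = ℕ.s≤s (ℕ.≤-reflexive (sym (ℕ.+-suc h h)))

  -1-sum-of-two-squares : ∃[ x ] ∃[ y ] x ℕ.≤ h × y ℕ.≤ h × + p ∣ + 1 + + x * + x + + y * + y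
  -1-sum-of-two-squares with pigeonhole p<2[h+1] (residue ∘ candidate ∘ splitAt (ℕ.suc h))
  ... | i , j , i<j , residue≡ = collision u v u≢v (%ℕ-≡⇒∣ {candidate u} {candidate v} p
          (fromℕ<-injective _ _ (n%ℕd<d (candidate u) p) (n%ℕd<d (candidate v) p) residue≡))
    where
    open ≡-Reasoning
    u = splitAt (ℕ.suc h) i
    v = splitAt (ℕ.suc h) j
    u≢v : u ≢ v
    u≢v u≡v = ℕ.<-irrefl (cong toℕ (begin
      i           ≡⟨ join-splitAt (ℕ.suc h) (ℕ.suc h) i ⟨
      join _ _ u  ≡⟨ cong (join _ _) u≡v ⟩
      join _ _ v  ≡⟨ join-splitAt (ℕ.suc h) (ℕ.suc h) j ⟩
      j           ∎)) i<j

  four-squares : SumOfFourSquares (+ p)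
  four-squares with -1-sum-of-two-squares
  ... | x , y , x≤h , y≤h , divides q N≡qp = descent prime m 0<m m<p (+ 1 , + x , + y , 0ℤ , N≡mp)
    where
    N′≡qp : norm₄ (+ 1) (+ x) (+ y) 0ℤ ≡ q * + p
    N′≡qp = trans (ℤ.+-identityʳ _) N≡qp

    m = ∣ q ∣

    n≡mp : 1 ℕ.+ x ℕ.* x ℕ.+ y ℕ.* y ℕ.+ 0 ≡ m ℕ.* p
    n≡mp = +u≡q*n⇒u≡∣q∣*n q p (trans (sym (norm₄≡+∣∣² (+ 1) (+ x) (+ y) 0ℤ)) N′≡qp)

    N≡mp : norm₄ (+ 1) (+ x) (+ y) 0ℤ ≡ + m * + p
    N≡mp = trans (norm₄≡+∣∣² (+ 1) (+ x) (+ y) 0ℤ) (trans (cong +_ n≡mp) (ℤ.pos-* m p))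

    0<m : 0 ℕ.< m
    0<m = ℕ.n≢0⇒n>0 (λ m≡0 → ℕ.1+n≢0 (trans n≡mp (cong (ℕ._* p) m≡0)))

    m<p : m ℕ.< p
    m<p = ℕ.*-cancelʳ-< p m p (begin-strict
      m ℕ.* p                          ≡⟨ n≡mp ⟨
      1 ℕ.+ x ℕ.* x ℕ.+ y ℕ.* y ℕ.+ 0  ≤⟨ ℕ.+-monoˡ-≤ 0 (ℕ.+-mono-≤ (ℕ.+-monoʳ-≤ 1 (≤h*p x≤h)) (≤h*p y≤h)) ⟩
      1 ℕ.+ h ℕ.* p ℕ.+ h ℕ.* p ℕ.+ 0  ≡⟨ regroup h p ⟩
      1 ℕ.+ (h ℕ.+ h) ℕ.* p            <⟨ ℕ.+-monoˡ-< ((h ℕ.+ h) ℕ.* p) 1<p ⟩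
      p ℕ.* p                          ∎)
      where
      open ℕ.≤-Reasoning
      1<p : 1 ℕ.< p
      1<p = ℕ.nonTrivial⇒n>1 p {{prime⇒nonTrivial prime}}
      ≤h*p : ∀ {z} → z ℕ.≤ h → z ℕ.* z ℕ.≤ h ℕ.* p
      ≤h*p z≤h = ℕ.*-mono-≤ z≤h (ℕ.≤-trans z≤h (ℕ.≤-trans (ℕ.m≤m+n h h) (ℕ.n≤1+n _)))
      regroup : ∀ h p → 1 ℕ.+ h ℕ.* p ℕ.+ h ℕ.* p ℕ.+ 0 ≡ 1 ℕ.+ (h ℕ.+ h) ℕ.* p
      regroup = ℕ.solve-∀

-- The vector part of q (e₁i + e₂j + e₃k) q̄ for the quaternion q = t + xi + yj + zk.
conjugate : ℤ → ℤ → ℤ → ℤ → ℤ → ℤ → ℤ → ℤ × ℤ × ℤ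
conjugate t x y z e₁ e₂ e₃ =
  (t * t + x * x - y * y - z * z) * e₁ + + 2 * (x * y - t * z) * e₂ + + 2 * (x * z + t * y) * e₃ ,
  + 2 * (x * y + t * z) * e₁ + (t * t - x * x + y * y - z * z) * e₂ + + 2 * (y * z - t * x) * e₃ ,
  + 2 * (x * z - t * y) * e₁ + + 2 * (y * z + t * x) * e₂ + (t * t - x * x - y * y + z * z) * e₃

conjugateᴾ : ∀ {n} → Polynomial n → Polynomial n → Polynomial n → Polynomial n →
  Polynomial n → Polynomial n → Polynomial n → Polynomial n × Polynomial n × Polynomial n
conjugateᴾ t x y z e₁ e₂ e₃ =
  (t :* t :+ x :* x :- y :* y :- z :* z) :* e₁ :+ con (+ 2) :* (x :* y :- t :* z) :* e₂
    :+ con (+ 2) :* (x :* z :+ t :* y) :* e₃ ,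
  con (+ 2) :* (x :* y :+ t :* z) :* e₁ :+ (t :* t :- x :* x :+ y :* y :- z :* z) :* e₂
    :+ con (+ 2) :* (y :* z :- t :* x) :* e₃ ,
  con (+ 2) :* (x :* z :- t :* y) :* e₁ :+ con (+ 2) :* (y :* z :+ t :* x) :* e₂
    :+ (t :* t :- x :* x :- y :* y :+ z :* z) :* e₃

norm₃-conjugate : ∀ t x y z e₁ e₂ e₃ →
  norm₃ (conjugate t x y z e₁ e₂ e₃) ≡ (e₁ * e₁ + e₂ * e₂ + e₃ * e₃) * (norm₄ t x y z * norm₄ t x y z)
norm₃-conjugate = +-*-Solver.solve 7 (λ t x y z e₁ e₂ e₃ →
  let a , b , c = conjugateᴾ t x y z e₁ e₂ e₃ in
  a :* a :+ b :* b :+ c :* c := (e₁ :* e₁ :+ e₂ :* e₂ :+ e₃ :* e₃) :* (norm₄ᴾ t x y z :* norm₄ᴾ t x y z)) refl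

conjugate-flip₂ : ∀ t x y z e₁ e₂ e₃ →
  proj₁ (proj₂ (conjugate t x y z e₁ e₂ e₃)) - proj₁ (proj₂ (conjugate t x y z e₁ (- e₂) e₃))
  ≡ + 2 * e₂ * ((t * t + y * y) - (x * x + z * z))
conjugate-flip₂ = +-*-Solver.solve 7 (λ t x y z e₁ e₂ e₃ →
  proj₁ (proj₂ (conjugateᴾ t x y z e₁ e₂ e₃)) :- proj₁ (proj₂ (conjugateᴾ t x y z e₁ (:- e₂) e₃))
  := con (+ 2) :* e₂ :* ((t :* t :+ y :* y) :- (x :* x :+ z :* z))) refl

conjugate-flip₃ : ∀ t x y z e₁ e₂ e₃ →
  proj₂ (proj₂ (conjugate t x y z e₁ e₂ e₃)) - proj₂ (proj₂ (conjugate t x y z e₁ e₂ (- e₃)))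
  ≡ + 2 * e₃ * ((t * t + z * z) - (x * x + y * y))
conjugate-flip₃ = +-*-Solver.solve 7 (λ t x y z e₁ e₂ e₃ →
  proj₂ (proj₂ (conjugateᴾ t x y z e₁ e₂ e₃)) :- proj₂ (proj₂ (conjugateᴾ t x y z e₁ e₂ (:- e₃)))
  := con (+ 2) :* e₃ :* ((t :* t :+ z :* z) :- (x :* x :+ y :* y))) refl

-- A = B would give u = v, against the parity of u + v; A = −B gives A = v − u, hence
-- (v − u)² = (u + v)², i.e. uv = 0.
odd-split : ∀ {u v} A B → Odd (u + v) → A * A ≡ (u + v) * (u + v) → B * B ≡ (u + v) * (u + v) →
  A - B ≡ + 2 * (v - u) → u ≡ 0ℤ ⊎ v ≡ 0ℤ
odd-split {u} {v} A B (k , u+v≡2k+1) A²≡S² B²≡S² A-B≡2[v-u]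
  with i*i≡j*j⇒i≡j⊎i≡-j A B (trans A²≡S² (sym B²≡S²))
... | inj₁ refl = ⊥-elim (2i≢2j+1 u k (trans 2u≡u+v u+v≡2k+1))
  where
  v≡u : v ≡ u
  v≡u = ℤ.i-j≡0⇒i≡j v u (ℤ.*-cancelˡ-≡ (+ 2) (v - u) 0ℤ (trans (sym A-B≡2[v-u]) (ℤ.+-inverseʳ A)))
  double : ∀ u → + 2 * u ≡ u + u
  double = solve-∀
  2u≡u+v : + 2 * u ≡ u + v
  2u≡u+v = trans (double u) (cong (_+_ u) (sym v≡u))
... | inj₂ refl = [ inj₁ ∘ u≡0 , inj₂ ∘ v≡0 ]′ (i*i≡j*j⇒i≡j⊎i≡-j (v - u) (u + v) [v-u]²≡[u+v]²)
  where
  double : ∀ w → + 2 * w ≡ w + w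
  double = solve-∀
  difference : ∀ u v → + 2 * u ≡ (u + v) - (v - u)
  difference = solve-∀
  sum : ∀ u v → + 2 * v ≡ (v - u) + (u + v)
  sum = solve-∀
  [v-u]²≡[u+v]² : (v - u) * (v - u) ≡ (u + v) * (u + v)
  [v-u]²≡[u+v]² = trans (cong (λ w → w * w) (sym (ℤ.*-cancelˡ-≡ (+ 2) (- B) (v - u)
    (trans (double (- B)) A-B≡2[v-u])))) A²≡S²
  u≡0 : v - u ≡ u + v → u ≡ 0ℤ
  u≡0 v-u≡u+v = ℤ.*-cancelˡ-≡ (+ 2) u 0ℤ (trans (difference u v) (ℤ.i≡j⇒i-j≡0 (sym v-u≡u+v)))
  v≡0 : v - u ≡ - (u + v) → v ≡ 0ℤ
  v≡0 v-u≡-[u+v] = ℤ.*-cancelˡ-≡ (+ 2) v 0ℤ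
    (trans (sum u v) (trans (cong (_+ (u + v)) v-u≡-[u+v]) (ℤ.+-inverseˡ (u + v))))

three-zero⇒square : ∀ t x y z →
  x * x + y * y ≡ 0ℤ ⊎ t * t + z * z ≡ 0ℤ → x * x + z * z ≡ 0ℤ ⊎ t * t + y * y ≡ 0ℤ →
  ∃[ w ] norm₄ t x y z ≡ w * w
three-zero⇒square t x y z (inj₁ x²+y²≡0) (inj₁ x²+z²≡0)
  with i*i+j*j≡0⇒i≡0×j≡0 x y x²+y²≡0 | i*i+j*j≡0⇒i≡0×j≡0 x z x²+z²≡0
... | refl , refl | _ , refl = t , only-t t
  where
  only-t : ∀ t → t * t + + 0 * + 0 + + 0 * + 0 + + 0 * + 0 ≡ t * t
  only-t = solve-∀
three-zero⇒square t x y z (inj₁ x²+y²≡0) (inj₂ t²+y²≡0)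
  with i*i+j*j≡0⇒i≡0×j≡0 x y x²+y²≡0 | i*i+j*j≡0⇒i≡0×j≡0 t y t²+y²≡0
... | refl , refl | refl , _ = z , only-z z
  where
  only-z : ∀ z → + 0 * + 0 + + 0 * + 0 + + 0 * + 0 + z * z ≡ z * z
  only-z = solve-∀
three-zero⇒square t x y z (inj₂ t²+z²≡0) (inj₁ x²+z²≡0)
  with i*i+j*j≡0⇒i≡0×j≡0 t z t²+z²≡0 | i*i+j*j≡0⇒i≡0×j≡0 x z x²+z²≡0
... | refl , refl | refl , _ = y , only-y y
  where
  only-y : ∀ y → + 0 * + 0 + + 0 * + 0 + y * y + + 0 * + 0 ≡ y * y
  only-y = solve-∀
three-zero⇒square t x y z (inj₂ t²+z²≡0) (inj₂ t²+y²≡0)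
  with i*i+j*j≡0⇒i≡0×j≡0 t z t²+z²≡0 | i*i+j*j≡0⇒i≡0×j≡0 t y t²+y²≡0
... | refl , refl | _ , refl = x , only-x x
  where
  only-x : ∀ x → + 0 * + 0 + x * x + + 0 * + 0 + + 0 * + 0 ≡ x * x
  only-x = solve-∀

odd-nonsquare-solution : ∀ {n} → Odd n → (∀ w → n ≢ w * w) → SumOfFourSquares n → NontrivialSolution n
odd-nonsquare-solution odd nonsquare (t , x , y , z , refl) =
  choose (trivial? S V₀) (trivial? S V₁) (trivial? S V₂)
  where
  S  = norm₄ t x y z
  V₀ = conjugate t x y z (+ 1) (+ 1) (+ 1)
  V₁ = conjugate t x y z (+ 1) (+ 1) (- + 1)
  V₂ = conjugate t x y z (+ 1) (- + 1) (+ 1)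

  solution : ∀ v → norm₃ v ≡ + 3 * (S * S) → ¬ IsTrivial S v → NontrivialSolution S
  solution (a , b , c) a²+b²+c²≡3S² ¬trivial = a , b , c , a²+b²+c²≡3S² , ¬trivial

  split₁ : ∀ t x y z → t * t + x * x + y * y + z * z ≡ (x * x + y * y) + (t * t + z * z)
  split₁ = solve-∀
  split₂ : ∀ t x y z → t * t + x * x + y * y + z * z ≡ (x * x + z * z) + (t * t + y * y)
  split₂ = solve-∀

  all-trivial⇒⊥ : IsTrivial S V₀ → IsTrivial S V₁ → IsTrivial S V₂ → ⊥
  all-trivial⇒⊥ (_ , ∣b₀∣≡∣S∣ , ∣c₀∣≡∣S∣) (_ , _ , ∣c₁∣≡∣S∣) (_ , ∣b₂∣≡∣S∣ , _) =
    let w , S≡w² = three-zero⇒square t x y z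
          (odd-split c₀ c₁ (subst Odd (split₁ t x y z) odd)
            (square c₀ ∣c₀∣≡∣S∣ (split₁ t x y z)) (square c₁ ∣c₁∣≡∣S∣ (split₁ t x y z))
            (conjugate-flip₃ t x y z (+ 1) (+ 1) (+ 1)))
          (odd-split b₀ b₂ (subst Odd (split₂ t x y z) odd)
            (square b₀ ∣b₀∣≡∣S∣ (split₂ t x y z)) (square b₂ ∣b₂∣≡∣S∣ (split₂ t x y z))
            (conjugate-flip₂ t x y z (+ 1) (+ 1) (+ 1)))
    in  nonsquare w S≡w²
    where
    b₀ = proj₁ (proj₂ V₀)
    c₀ = proj₂ (proj₂ V₀)
    c₁ = proj₂ (proj₂ V₁)
    b₂ = proj₁ (proj₂ V₂)
    square : ∀ a {S′} → ∣ a ∣ ≡ ∣ S ∣ → S ≡ S′ → a * a ≡ S′ * S′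
    square a ∣a∣≡∣S∣ refl = ∣i∣≡∣j∣⇒i*i≡j*j a S ∣a∣≡∣S∣

  choose : Dec (IsTrivial S V₀) → Dec (IsTrivial S V₁) → Dec (IsTrivial S V₂) → NontrivialSolution S
  choose (no ¬trivial) _ _ = solution V₀ (norm₃-conjugate t x y z (+ 1) (+ 1) (+ 1)) ¬trivial
  choose (yes _) (no ¬trivial) _ = solution V₁ (norm₃-conjugate t x y z (+ 1) (+ 1) (- + 1)) ¬trivial
  choose (yes _) (yes _) (no ¬trivial) = solution V₂ (norm₃-conjugate t x y z (+ 1) (- + 1) (+ 1)) ¬trivial
  choose (yes τ₀) (yes τ₁) (yes τ₂) = ⊥-elim (all-trivial⇒⊥ τ₀ τ₁ τ₂)

prime⇒nonsquare : ∀ {p} → Prime p → ∀ w → + p ≢ w * w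
prime⇒nonsquare {p} p-prime w +p≡w² =
  ℕ.<-irrefl (sym p≡1) (ℕ.nonTrivial⇒n>1 p {{prime⇒nonTrivial p-prime}})
  where
  p≡∣w∣² : p ≡ ∣ w ∣ ℕ.* ∣ w ∣
  p≡∣w∣² = ℤ.+-injective (trans +p≡w² (i*i≡+∣i∣*∣i∣ w))
  p≡1 : p ≡ 1
  p≡1 with prime⇒irreducible p-prime (ℕ.divides ∣ w ∣ p≡∣w∣²)
  ... | inj₁ ∣w∣≡1 = trans p≡∣w∣² (cong (λ k → k ℕ.* k) ∣w∣≡1)
  ... | inj₂ ∣w∣≡p = sym (ℕ.*-cancelʳ-≡ 1 p p {{prime⇒nonZero p-prime}}
                          (trans (ℕ.*-identityˡ p) (trans p≡∣w∣² (cong (λ k → k ℕ.* k) ∣w∣≡p))))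

odd-prime-solution : ∀ {h} → Prime (ℕ.suc (h ℕ.+ h)) → NontrivialSolution (+ ℕ.suc (h ℕ.+ h))
odd-prime-solution {h} p-prime =
  odd-nonsquare-solution (1+h+h-odd h) (prime⇒nonsquare p-prime) (four-squares {h} p-prime)

scale-solution : ∀ {d} e .{{_ : NonZero e}} → NontrivialSolution d → NontrivialSolution (e * d)
scale-solution {d} e (a , b , c , a²+b²+c²≡3d² , ¬trivial) =
  e * a , e * b , e * c , scaled , λ (ea , eb , ec) → ¬trivial (cancel a ea , cancel b eb , cancel c ec)
  where
  open ≡-Reasoning
  factor : ∀ e a b c → e * a * (e * a) + e * b * (e * b) + e * c * (e * c) ≡ e * e * (a * a + b * b + c * c)
  factor = solve-∀
  regroup : ∀ e d → e * e * (+ 3 * (d * d)) ≡ + 3 * (e * d * (e * d))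
  regroup = solve-∀
  scaled : e * a * (e * a) + e * b * (e * b) + e * c * (e * c) ≡ + 3 * (e * d * (e * d))
  scaled = begin
    e * a * (e * a) + e * b * (e * b) + e * c * (e * c)  ≡⟨ factor e a b c ⟩
    e * e * (a * a + b * b + c * c)                      ≡⟨ cong (e * e *_) a²+b²+c²≡3d² ⟩
    e * e * (+ 3 * (d * d))                              ≡⟨ regroup e d ⟩
    + 3 * (e * d * (e * d))                              ∎
  cancel : ∀ w → ∣ e * w ∣ ≡ ∣ e * d ∣ → ∣ w ∣ ≡ ∣ d ∣
  cancel w ∣ew∣≡∣ed∣ = ℕ.*-cancelˡ-≡ (∣ w ∣) (∣ d ∣) (∣ e ∣) (begin
    ∣ e ∣ ℕ.* ∣ w ∣  ≡⟨ ℤ.abs-* e w ⟨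
    ∣ e * w ∣        ≡⟨ ∣ew∣≡∣ed∣ ⟩
    ∣ e * d ∣        ≡⟨ ℤ.abs-* e d ⟩
    ∣ e ∣ ℕ.* ∣ d ∣  ∎)

multiple-solution : ∀ {p n} .{{_ : ℕ.NonZero n}} → p ℕ.∣ n →
  NontrivialSolution (+ p) → NontrivialSolution (+ n)
multiple-solution {p} {n} (ℕ.divides e n≡ep) = subst NontrivialSolution ep≡n ∘ scale-solution (+ e) {{e≢0}}
  where
  ep≡n : + e * + p ≡ + n
  ep≡n = trans (sym (ℤ.pos-* e p)) (cong +_ (sym n≡ep))
  e≢0 : ℕ.NonZero e
  e≢0 = ℕ.≢-nonZero λ e≡0 → ℕ.≢-nonZero⁻¹ n (trans n≡ep (cong (ℕ._* p) e≡0))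

prime-divisor : ∀ {n} → 2 ℕ.≤ n → ∃[ p ] Prime p × p ℕ.∣ n
prime-divisor {n} (ℕ.s≤s (ℕ.s≤s _)) with factorise n
... | record { factors = p ∷ ps ; isFactorisation = n≡p*∏ps ; factorsPrime = p-prime ∷ _ } =
  p , p-prime , ℕ.divides (product ps) (trans n≡p*∏ps (ℕ.*-comm p (product ps)))

proposition3p2 : (d : ℤ) → (∃[ k ] d ≡ + 2 * k + + 1) → + 3 ≤ d → ∃[ a ] ∃[ b ] ∃[ c ] ((a * a + b * b + c * c ≡ + 3 * (d * d)) × ¬ ((∣ a ∣ ≡ ∣ d ∣) × (∣ b ∣ ≡ ∣ d ∣) × (∣ c ∣ ≡ ∣ d ∣)))
proposition3p2 (+ n) odd (+≤+ 3≤n@(ℕ.s≤s _)) with prime-divisor (ℕ.<⇒≤ 3≤n)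
... | p , p-prime , p∣n with ∣odd⇒odd odd p∣n
... | h , refl = multiple-solution p∣n (odd-prime-solution {h} p-prime)
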